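{- Let $\epsilon\in\{1,-1\}^n$ with $\epsilon_1=1$ and $\epsilon_n=-1$. There is a bijection between the set $\mathtt{For}(\epsilon)$ of forests associated with $\epsilon$ and the set $\mathcal{N}(n;\epsilon)$ of networks.
   Context: A network on $n$ points is a set $E$ of pairs $(i,j)$ with $1\le i<j\le n$ (directed edges; $i$ a source, $j$ a sink) with no $(i,j),(j,k)\in E$, satisfying (B1): if $(i,k),(j,l)\in E$ with $i<j<k<l$ then $(j,k)\in E$. $\mathcal{N}(n;\epsilon)$ is the set of such networks in which every source $i$ has $\epsilon_i=1$ and every sink $j$ has $\epsilon_j=-1$. Let $i_1<\dots<i_r$ be the positions of the entries $-1$ in $\epsilon$, and define $\lambda(\epsilon)=(\lambda_1,\dots,\lambda_r)$ by $\lambda_t=\#\{k:\epsilon_k=1,\ k<i_{r+1-t}\}$; view it as a Young diagram in French notation (row $t$ from the bottom has $\lambda_t$ cells, left justified). A forest is a filling of the cells of $\lambda(\epsilon)$ in which each cell is either empty or pointed, such that (F1): for every pointed cell $c$, it is not the case that there is both a pointed cell below $c$ in the same column and a pointed cell to the left of $c$ in the same row. $\mathtt{For}(\epsilon)$ is the set of forests for $\lambda(\epsilon)$. -}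

module Defs where

open import Data.Bool using (Bool; true; false)
open import Data.Nat using (ℕ; zero; suc; _<_)
open import Data.Fin as Fin using (Fin)
open import Data.List using (List; []; _∷_; reverse; map; length)
open import Data.Vec using (Vec; lookup; toList)
open import Data.Product using (Σ; _×_; ∃-syntax)
open import Relation.Nullary using (¬_)
open import Relation.Binary.PropositionalEquality using (_≡_)

-- Sign vectors: ε k = true means ε_k = 1, false means ε_k = -1.
Sign : ℕ → Set
Sign n = Vec Bool n

countsFrom : ℕ → List Bool → List ℕ
countsFrom c []           = []
countsFrom c (true  ∷ xs) = countsFrom (suc c) xs
countsFrom c (false ∷ xs) = c ∷ countsFrom c xs

-- λ(ε) = (λ_1,…,λ_r) with λ_t = #{k : ε_k = 1, k < i_{r+1-t}}:
-- the list of counts for i_1,…,i_r, reversed.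
shape : ∀ {n} → Sign n → List ℕ
shape ε = reverse (countsFrom 0 (toList ε))

-- A filling is a list of rows (row 0 = bottom row, French notation),
-- each row a list of cells (column 0 = leftmost); true = pointed.
Filling : Set
Filling = List (List Bool)

cellAt : List Bool → ℕ → Bool
cellAt []       _       = false
cellAt (b ∷ bs) zero    = b
cellAt (b ∷ bs) (suc c) = cellAt bs c

pointed : Filling → ℕ → ℕ → Set
pointed []       _       c = cellAt [] c ≡ true
pointed (r ∷ rs) zero    c = cellAt r c ≡ true
pointed (r ∷ rs) (suc t) c = pointed rs t c

F1 : Filling → Set
F1 F = ∀ t c → pointed F t c →
  ¬ ((∃[ t' ] (t' < t × pointed F t' c)) × (∃[ c' ] (c' < c × pointed F t c')))

record Forest {n : ℕ} (ε : Sign n) : Set where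
  constructor forest
  field
    filling    : Filling
    .hasShape  : map length filling ≡ shape ε
    .condF1    : F1 filling

-- Edge relation as an n×n Boolean matrix: edge E i j = true iff (i,j) ∈ E.
EdgeSet : ℕ → Set
EdgeSet n = Vec (Vec Bool n) n

edge : ∀ {n} → EdgeSet n → Fin n → Fin n → Set
edge E i j = lookup (lookup E i) j ≡ true

record IsNetwork {n : ℕ} (ε : Sign n) (E : EdgeSet n) : Set where
  field
    ordered   : ∀ i j → edge E i j → i Fin.< j
    noPath    : ∀ i j k → ¬ (edge E i j × edge E j k)
    B1        : ∀ i j k l → i Fin.< j → j Fin.< k → k Fin.< l →
                edge E i k → edge E j l → edge E j k
    sourceSgn : ∀ i j → edge E i j → lookup ε i ≡ true
    sinkSgn   : ∀ i j → edge E i j → lookup ε j ≡ false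

record Network {n : ℕ} (ε : Sign n) : Set where
  constructor network
  field
    edges      : EdgeSet n
    .isNetwork : IsNetwork ε edges

{-# OPTIONS --safe #-}
module Submission where

-- Record a network E as the filling of λ(ε) whose cell in the row of a sink
-- k and the column of a source j is pointed iff (j , k) ∈ E.  Below a cell
-- lie the rows of later sinks and to its left the columns of earlier
-- sources, so (B1) says exactly that a cell having a pointed cell below it
-- and a pointed cell to its left is pointed: networks are the closed
-- fillings.  Closed fillings and forests correspond by adding, resp.
-- removing, every cell that has a pointed cell below it and one to its
-- left.  Neither operation changes which cells have a pointed cell below
-- them, or to their left, so each undoes the other.

open import Defs
open import Data.Bool using (Bool; true; false; _∧_; _∨_; not)
import Data.Bool as Bool
open import Data.Bool.Properties using (∨-assoc; ∨-identityʳ; ∨-zeroʳ)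
open import Data.Empty using (⊥; ⊥-elim)
open import Data.Fin as Fin using (Fin; zero; suc)
import Data.Fin.Properties as Finₚ
open import Data.List as List using (List; []; _∷_; _∷ʳ_; [_]; map; length; reverse; drop; zipWith)
import Data.List.Properties as Listₚ
open import Data.Nat using (ℕ; zero; suc; _<_; _≤_; z≤n; s≤s)
open import Data.Nat.Properties using (suc-injective; ≤-refl; ≤-reflexive; <-trans; <-irrefl; <⇒≱; +-comm; n≤1+n; m≤n⇒m≤1+n; m<n⇒m<1+n; m<1+n⇒m<n∨m≡n)
open import Data.Product using (_×_; _,_; proj₁; proj₂; ∃-syntax)
open import Data.Sum using (_⊎_; inj₁; inj₂)
open import Data.Unit using (⊤; tt)
open import Data.Vec as Vec using (Vec; []; _∷_; lookup; tabulate; head; last)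
import Data.Vec.Properties as Vecₚ
open import Function.Bundles using (_⤖_; _↔_; mk↔ₛ′)
open import Function.Construct.Composition using (_↔-∘_)
open import Function.Properties.Inverse using (↔⇒⤖)
open import Relation.Nullary using (¬_; Dec; yes; no; does)
open import Relation.Nullary.Decidable using (_×-dec_; dec-true; dec-false; recompute)
open import Relation.Binary.PropositionalEquality using (_≡_; refl; sym; trans; cong; cong₂; subst; subst₂; module ≡-Reasoning)

row : Filling → ℕ → List Bool
row []       _       = []
row (r ∷ rs) zero    = r
row (r ∷ rs) (suc t) = row rs t

cell : Filling → ℕ → ℕ → Bool
cell F t c = cellAt (row F t) c

pointed⇒cell : ∀ F t c → pointed F t c → cell F t c ≡ true
pointed⇒cell []      t       c p = p
pointed⇒cell (r ∷ F) zero    c p = p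
pointed⇒cell (r ∷ F) (suc t) c p = pointed⇒cell F t c p

cell⇒pointed : ∀ F t c → cell F t c ≡ true → pointed F t c
cell⇒pointed []      t       c p = p
cell⇒pointed (r ∷ F) zero    c p = p
cell⇒pointed (r ∷ F) (suc t) c p = cell⇒pointed F t c p

cellAt⇒< : ∀ r c → cellAt r c ≡ true → c < length r
cellAt⇒< (x ∷ r) zero    p = s≤s z≤n
cellAt⇒< (x ∷ r) (suc c) p = s≤s (cellAt⇒< r c p)

row-index<length : ∀ F t c → c < length (row F t) → t < length F
row-index<length (r ∷ F) zero    c lt = s≤s z≤n
row-index<length (r ∷ F) (suc t) c lt = s≤s (row-index<length F t c lt)

LeftOf : Filling → ℕ → ℕ → Set
LeftOf F t c = ∃[ c' ] (c' < c × cell F t c' ≡ true)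

BelowOf : Filling → ℕ → ℕ → Set
BelowOf F t c = ∃[ t' ] (t' < t × cell F t' c ≡ true)

Closed : Filling → Set
Closed F = ∀ t c → c < length (row F t) → BelowOf F t c → LeftOf F t c → cell F t c ≡ true

zipOr : List Bool → List Bool → List Bool
zipOr []       ys = ys
zipOr (x ∷ xs) ys = (x ∨ cellAt ys 0) ∷ zipOr xs (drop 1 ys)

cellAt-drop1 : ∀ ys c → cellAt (drop 1 ys) c ≡ cellAt ys (suc c)
cellAt-drop1 []       c = refl
cellAt-drop1 (y ∷ ys) c = refl

cellAt-zipOr : ∀ xs ys c → cellAt (zipOr xs ys) c ≡ cellAt xs c ∨ cellAt ys c
cellAt-zipOr []       ys c       = refl
cellAt-zipOr (x ∷ xs) ys zero    = refl
cellAt-zipOr (x ∷ xs) ys (suc c) =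
  trans (cellAt-zipOr xs (drop 1 ys) c) (cong (cellAt xs c ∨_) (cellAt-drop1 ys c))

-- The rule
-- receives whether some cell of the input to the left of the current one,
-- resp. below it, is pointed, and the current cell.
CellRule : Set
CellRule = Bool → Bool → Bool → Bool

CellProperty : Set₁
CellProperty = Bool → Bool → Bool → Set

scanRow : CellRule → Bool → List Bool → List Bool → List Bool
scanRow f l b []       = []
scanRow f l b (x ∷ xs) = f l (cellAt b 0) x ∷ scanRow f (l ∨ x) (drop 1 b) xs

scan : CellRule → List Bool → Filling → Filling
scan f b []       = []
scan f b (r ∷ rs) = scanRow f false b r ∷ scan f (zipOr r b) rs

AllRow : CellProperty → Bool → List Bool → List Bool → Set
AllRow P l b []       = ⊤
AllRow P l b (x ∷ xs) = P l (cellAt b 0) x × AllRow P (l ∨ x) (drop 1 b) xs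

AllCells : CellProperty → List Bool → Filling → Set
AllCells P b []       = ⊤
AllCells P b (r ∷ rs) = AllRow P false b r × AllCells P (zipOr r b) rs

length-scanRow : ∀ f l b r → length (scanRow f l b r) ≡ length r
length-scanRow f l b []      = refl
length-scanRow f l b (x ∷ r) = cong suc (length-scanRow f (l ∨ x) (drop 1 b) r)

shape-scan : ∀ f b F → map length (scan f b F) ≡ map length F
shape-scan f b []      = refl
shape-scan f b (r ∷ F) = cong₂ _∷_ (length-scanRow f false b r) (shape-scan f (zipOr r b) F)

-- A rule with these two properties feeds a second scan over its output the
-- same information as the first scan received.
record PreservesSupport (f : CellRule) : Set where
  field
    keepsLeft  : ∀ l h x → l ∨ f l h x ≡ l ∨ x
    keepsBelow : ∀ l h x → f l h x ∨ h ≡ x ∨ h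

module _ {f : CellRule} (pres : PreservesSupport f) where
  open PreservesSupport pres

  zipOr-scanRow : ∀ l b r → zipOr (scanRow f l b r) b ≡ zipOr r b
  zipOr-scanRow l b []      = refl
  zipOr-scanRow l b (x ∷ r) =
    cong₂ _∷_ (keepsBelow l (cellAt b 0) x) (zipOr-scanRow (l ∨ x) (drop 1 b) r)

  module _ {g : CellRule} {P : CellProperty}
           (g∘f : ∀ {l h x} → P l h x → g l h (f l h x) ≡ x) where

    scanRow-inverse : ∀ l b r → AllRow P l b r → scanRow g l b (scanRow f l b r) ≡ r
    scanRow-inverse l b []      _        = refl
    scanRow-inverse l b (x ∷ r) (p , ps) rewrite keepsLeft l (cellAt b 0) x =
      cong₂ _∷_ (g∘f p) (scanRow-inverse (l ∨ x) (drop 1 b) r ps)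

    scan-inverse : ∀ b F → AllCells P b F → scan g b (scan f b F) ≡ F
    scan-inverse b []      _        = refl
    scan-inverse b (r ∷ F) (p , ps) rewrite zipOr-scanRow false b r =
      cong₂ _∷_ (scanRow-inverse false b r p) (scan-inverse (zipOr r b) F ps)

  module _ {P : CellProperty} (establishes : ∀ l h x → P l h (f l h x)) where

    allRow-scanRow : ∀ l b r → AllRow P l b (scanRow f l b r)
    allRow-scanRow l b []      = tt
    allRow-scanRow l b (x ∷ r) rewrite keepsLeft l (cellAt b 0) x =
      establishes l (cellAt b 0) x , allRow-scanRow (l ∨ x) (drop 1 b) r

    allCells-scan : ∀ b F → AllCells P b (scan f b F)
    allCells-scan b []      = tt
    allCells-scan b (r ∷ F) rewrite zipOr-scanRow false b r =
      allRow-scanRow false b r , allCells-scan (zipOr r b) F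

anyBefore : List Bool → ℕ → Bool
anyBefore r        zero    = false
anyBefore []       (suc c) = false
anyBefore (x ∷ xs) (suc c) = x ∨ anyBefore xs c

anyBefore⇒∃ : ∀ r c → anyBefore r c ≡ true → ∃[ c' ] (c' < c × cellAt r c' ≡ true)
anyBefore⇒∃ (true  ∷ r) (suc c) p = zero , s≤s z≤n , refl
anyBefore⇒∃ (false ∷ r) (suc c) p with anyBefore⇒∃ r c p
... | c' , c'<c , q = suc c' , s≤s c'<c , q

∃⇒anyBefore : ∀ r c c' → c' < c → cellAt r c' ≡ true → anyBefore r c ≡ true
∃⇒anyBefore (true  ∷ r) (suc c) c'       c'<c       q = refl
∃⇒anyBefore (false ∷ r) (suc c) (suc c') (s≤s c'<c) q = ∃⇒anyBefore r c c' c'<c q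

columnsBelow : List Bool → Filling → ℕ → List Bool
columnsBelow b F       zero    = b
columnsBelow b []      (suc t) = b
columnsBelow b (r ∷ F) (suc t) = columnsBelow (zipOr r b) F t

∨-true : ∀ a b → a ∨ b ≡ true → a ≡ true ⊎ b ≡ true
∨-true true  b p = inj₁ refl
∨-true false b p = inj₂ p

columnsBelow⇒ : ∀ b F t c → cellAt (columnsBelow b F t) c ≡ true →
                cellAt b c ≡ true ⊎ BelowOf F t c
columnsBelow⇒ b F       zero    c p = inj₁ p
columnsBelow⇒ b []      (suc t) c p = inj₁ p
columnsBelow⇒ b (r ∷ F) (suc t) c p with columnsBelow⇒ (zipOr r b) F t c p
... | inj₂ (t' , t'<t , q) = inj₂ (suc t' , s≤s t'<t , q)
... | inj₁ q with ∨-true (cellAt r c) (cellAt b c) (trans (sym (cellAt-zipOr r b c)) q)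
...   | inj₁ q′ = inj₂ (zero , s≤s z≤n , q′)
...   | inj₂ q′ = inj₁ q′

columnsBelow-mono : ∀ b F t c → cellAt b c ≡ true → cellAt (columnsBelow b F t) c ≡ true
columnsBelow-mono b F       zero    c p = p
columnsBelow-mono b []      (suc t) c p = p
columnsBelow-mono b (r ∷ F) (suc t) c p = columnsBelow-mono (zipOr r b) F t c
  (trans (cellAt-zipOr r b c) (trans (cong (cellAt r c ∨_) p) (∨-zeroʳ _)))

BelowOf⇒columnsBelow : ∀ b F t c → BelowOf F t c → cellAt (columnsBelow b F t) c ≡ true
BelowOf⇒columnsBelow b (r ∷ F) (suc t) c (zero , _ , q) =
  columnsBelow-mono (zipOr r b) F t c (trans (cellAt-zipOr r b c) (cong (_∨ cellAt b c) q))
BelowOf⇒columnsBelow b (r ∷ F) (suc t) c (suc t' , s≤s t'<t , q) =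
  BelowOf⇒columnsBelow (zipOr r b) F t c (t' , t'<t , q)

columnsBelow[]⇒BelowOf : ∀ F t c → cellAt (columnsBelow [] F t) c ≡ true → BelowOf F t c
columnsBelow[]⇒BelowOf F t c p with columnsBelow⇒ [] F t c p
... | inj₂ below = below

module _ {P : CellProperty} where

  AllRow⇒pointwise : ∀ l b r → AllRow P l b r →
    ∀ c → c < length r → P (l ∨ anyBefore r c) (cellAt b c) (cellAt r c)
  AllRow⇒pointwise l b (x ∷ r) (p , ps) zero    _          =
    subst (λ l′ → P l′ (cellAt b 0) x) (sym (∨-identityʳ l)) p
  AllRow⇒pointwise l b (x ∷ r) (p , ps) (suc c) (s≤s c<len) =
    subst₂ (λ l′ h → P l′ h (cellAt r c)) (∨-assoc l x (anyBefore r c)) (cellAt-drop1 b c)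
      (AllRow⇒pointwise (l ∨ x) (drop 1 b) r ps c c<len)

  pointwise⇒AllRow : ∀ l b r →
    (∀ c → c < length r → P (l ∨ anyBefore r c) (cellAt b c) (cellAt r c)) → AllRow P l b r
  pointwise⇒AllRow l b []      _ = tt
  pointwise⇒AllRow l b (x ∷ r) h =
    subst (λ l′ → P l′ (cellAt b 0) x) (∨-identityʳ l) (h zero (s≤s z≤n)) ,
    pointwise⇒AllRow (l ∨ x) (drop 1 b) r λ c c<len →
      subst₂ (λ l′ h′ → P l′ h′ (cellAt r c))
        (sym (∨-assoc l x (anyBefore r c))) (sym (cellAt-drop1 b c))
        (h (suc c) (s≤s c<len))

  Pointwise : List Bool → Filling → Set
  Pointwise b F = ∀ t c → c < length (row F t) →
    P (anyBefore (row F t) c) (cellAt (columnsBelow b F t) c) (cell F t c)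

  AllCells⇒Pointwise : ∀ b F → AllCells P b F → Pointwise b F
  AllCells⇒Pointwise b (r ∷ F) (p , ps) zero    = AllRow⇒pointwise false b r p
  AllCells⇒Pointwise b (r ∷ F) (p , ps) (suc t) = AllCells⇒Pointwise (zipOr r b) F ps t

  Pointwise⇒AllCells : ∀ b F → Pointwise b F → AllCells P b F
  Pointwise⇒AllCells b []      _ = tt
  Pointwise⇒AllCells b (r ∷ F) h =
    pointwise⇒AllRow false b r (h zero) , Pointwise⇒AllCells (zipOr r b) F (λ t → h (suc t))

saturateCell : CellRule
saturateCell l h x = x ∨ (l ∧ h)

pruneCell : CellRule
pruneCell l h x = x ∧ not (l ∧ h)

ClosedCell : CellProperty
ClosedCell l h x = l ≡ true → h ≡ true → x ≡ true

ForestCell : CellProperty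
ForestCell l h x = x ≡ true → l ≡ true → h ≡ true → ⊥

saturateCell-preservesSupport : PreservesSupport saturateCell
saturateCell-preservesSupport = record { keepsLeft = keepsLeft ; keepsBelow = keepsBelow }
  where
  keepsLeft : ∀ l h x → l ∨ saturateCell l h x ≡ l ∨ x
  keepsLeft true  h x     = refl
  keepsLeft false h true  = refl
  keepsLeft false h false = refl
  keepsBelow : ∀ l h x → saturateCell l h x ∨ h ≡ x ∨ h
  keepsBelow l     h     true  = refl
  keepsBelow true  true  false = refl
  keepsBelow true  false false = refl
  keepsBelow false h     false = refl

pruneCell-preservesSupport : PreservesSupport pruneCell
pruneCell-preservesSupport = record { keepsLeft = keepsLeft ; keepsBelow = keepsBelow }
  where
  keepsLeft : ∀ l h x → l ∨ pruneCell l h x ≡ l ∨ x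
  keepsLeft true  h x     = refl
  keepsLeft false h true  = refl
  keepsLeft false h false = refl
  keepsBelow : ∀ l h x → pruneCell l h x ∨ h ≡ x ∨ h
  keepsBelow true  true  true  = refl
  keepsBelow true  false true  = refl
  keepsBelow false h     true  = refl
  keepsBelow l     h     false = refl

saturateCell-closed : ∀ l h x → ClosedCell l h (saturateCell l h x)
saturateCell-closed true true x _ _ = ∨-zeroʳ x

pruneCell-forest : ∀ l h x → ForestCell l h (pruneCell l h x)
pruneCell-forest true true true ()

pruneCell∘saturateCell : ∀ {l h x} → ForestCell l h x → pruneCell l h (saturateCell l h x) ≡ x
pruneCell∘saturateCell {true}  {true}  {true}  p = ⊥-elim (p refl refl refl)
pruneCell∘saturateCell {true}  {true}  {false} p = refl
pruneCell∘saturateCell {true}  {false} {true}  p = refl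
pruneCell∘saturateCell {true}  {false} {false} p = refl
pruneCell∘saturateCell {false} {h}     {true}  p = refl
pruneCell∘saturateCell {false} {h}     {false} p = refl

saturateCell∘pruneCell : ∀ {l h x} → ClosedCell l h x → saturateCell l h (pruneCell l h x) ≡ x
saturateCell∘pruneCell {true}  {true}  {x}     p = trans (∨-zeroʳ _) (sym (p refl refl))
saturateCell∘pruneCell {true}  {false} {true}  p = refl
saturateCell∘pruneCell {true}  {false} {false} p = refl
saturateCell∘pruneCell {false} {h}     {true}  p = refl
saturateCell∘pruneCell {false} {h}     {false} p = refl

saturate : Filling → Filling
saturate = scan saturateCell []

prune : Filling → Filling
prune = scan pruneCell []

F1⇒AllCells : ∀ F → F1 F → AllCells ForestCell [] F
F1⇒AllCells F f1 = Pointwise⇒AllCells [] F λ t c _ p left below →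
  f1 t c (cell⇒pointed F t c p) (pointedBelow t c below , pointedLeft t c left)
  where
  pointedBelow : ∀ t c → cellAt (columnsBelow [] F t) c ≡ true →
                 ∃[ t' ] (t' < t × pointed F t' c)
  pointedBelow t c q with columnsBelow[]⇒BelowOf F t c q
  ... | t' , t'<t , q′ = t' , t'<t , cell⇒pointed F t' c q′
  pointedLeft : ∀ t c → anyBefore (row F t) c ≡ true → ∃[ c' ] (c' < c × pointed F t c')
  pointedLeft t c q with anyBefore⇒∃ (row F t) c q
  ... | c' , c'<c , q′ = c' , c'<c , cell⇒pointed F t c' q′

AllCells⇒F1 : ∀ F → AllCells ForestCell [] F → F1 F
AllCells⇒F1 F all t c p ((t' , t'<t , below) , (c' , c'<c , left)) =
  AllCells⇒Pointwise [] F all t c (cellAt⇒< (row F t) c v) v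
    (∃⇒anyBefore (row F t) c c' c'<c (pointed⇒cell F t c' left))
    (BelowOf⇒columnsBelow [] F t c (t' , t'<t , pointed⇒cell F t' c below))
  where v = pointed⇒cell F t c p

Closed⇒AllCells : ∀ F → Closed F → AllCells ClosedCell [] F
Closed⇒AllCells F closed = Pointwise⇒AllCells [] F λ t c c<len left below →
  closed t c c<len (columnsBelow[]⇒BelowOf F t c below) (anyBefore⇒∃ (row F t) c left)

AllCells⇒Closed : ∀ F → AllCells ClosedCell [] F → Closed F
AllCells⇒Closed F all t c c<len (t' , t'<t , below) (c' , c'<c , left) =
  AllCells⇒Pointwise [] F all t c c<len
    (∃⇒anyBefore (row F t) c c' c'<c left) (BelowOf⇒columnsBelow [] F t c (t' , t'<t , below))

record ClosedFilling {n : ℕ} (ε : Sign n) : Set where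
  constructor closedFilling
  field
    filling   : Filling
    .hasShape : map length filling ≡ shape ε
    .isClosed : Closed filling

-- The proof fields are irrelevant, so an equation between the underlying
-- data is only available irrelevantly; decidable equality recomputes it.
forest-≡ : ∀ {n} {ε : Sign n} {F G} .{s c s′ c′} → .(F ≡ G) →
           _≡_ {A = Forest ε} (forest F s c) (forest G s′ c′)
forest-≡ {F = F} {G} F≡G with recompute (Listₚ.≡-dec (Listₚ.≡-dec Bool._≟_) F G) F≡G
... | refl = refl

closedFilling-≡ : ∀ {n} {ε : Sign n} {F G} .{s c s′ c′} → .(F ≡ G) →
                  _≡_ {A = ClosedFilling ε} (closedFilling F s c) (closedFilling G s′ c′)
closedFilling-≡ {F = F} {G} F≡G
  with recompute (Listₚ.≡-dec (Listₚ.≡-dec Bool._≟_) F G) F≡G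
... | refl = refl

network-≡ : ∀ {n} {ε : Sign n} {E E′} .{p p′} → .(E ≡ E′) →
            _≡_ {A = Network ε} (network E p) (network E′ p′)
network-≡ {E = E} {E′} E≡E′ with recompute (Vecₚ.≡-dec (Vecₚ.≡-dec Bool._≟_) E E′) E≡E′
... | refl = refl

forest↔closedFilling : ∀ {n} (ε : Sign n) → Forest ε ↔ ClosedFilling ε
forest↔closedFilling ε = mk↔ₛ′ to from to∘from from∘to
  where
  to : Forest ε → ClosedFilling ε
  to (forest F s f1) = closedFilling (saturate F) (trans (shape-scan saturateCell [] F) s)
    (AllCells⇒Closed _ (allCells-scan saturateCell-preservesSupport saturateCell-closed [] F))

  from : ClosedFilling ε → Forest ε
  from (closedFilling F s c) = forest (prune F) (trans (shape-scan pruneCell [] F) s)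
    (AllCells⇒F1 _ (allCells-scan pruneCell-preservesSupport pruneCell-forest [] F))

  to∘from : ∀ C → to (from C) ≡ C
  to∘from (closedFilling F s c) = closedFilling-≡
    (scan-inverse pruneCell-preservesSupport saturateCell∘pruneCell [] F (Closed⇒AllCells F c))

  from∘to : ∀ T → from (to T) ≡ T
  from∘to (forest F s f1) = forest-≡
    (scan-inverse saturateCell-preservesSupport pruneCell∘saturateCell [] F (F1⇒AllCells F f1))

minusOnes : ∀ {n} → Sign n → ℕ
minusOnes []          = 0
minusOnes (true  ∷ ε) = minusOnes ε
minusOnes (false ∷ ε) = suc (minusOnes ε)

-- The edge (j , k) is the cell in row minusOnesAfter ε k, column onesBefore ε j.
minusOnesAfter : ∀ {n} → Sign n → Fin n → ℕ
minusOnesAfter (_ ∷ ε) zero    = minusOnes ε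
minusOnesAfter (_ ∷ ε) (suc k) = minusOnesAfter ε k

onesBefore : ∀ {n} → Sign n → Fin n → ℕ
onesBefore (_     ∷ ε) zero    = 0
onesBefore (true  ∷ ε) (suc j) = suc (onesBefore ε j)
onesBefore (false ∷ ε) (suc j) = onesBefore ε j

Slot : ∀ {n} → Sign n → Fin n → Fin n → Set
Slot ε j k = lookup ε j ≡ true × lookup ε k ≡ false × j Fin.< k

slot? : ∀ {n} (ε : Sign n) j k → Dec (Slot ε j k)
slot? ε j k = (lookup ε j Bool.≟ true) ×-dec (lookup ε k Bool.≟ false) ×-dec (j Finₚ.<? k)

minusOnesAfter≤minusOnes : ∀ {n} (ε : Sign n) k → minusOnesAfter ε k ≤ minusOnes ε
minusOnesAfter≤minusOnes (true  ∷ ε) zero    = ≤-refl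
minusOnesAfter≤minusOnes (false ∷ ε) zero    = n≤1+n _
minusOnesAfter≤minusOnes (true  ∷ ε) (suc k) = minusOnesAfter≤minusOnes ε k
minusOnesAfter≤minusOnes (false ∷ ε) (suc k) = m≤n⇒m≤1+n (minusOnesAfter≤minusOnes ε k)

minusOnesAfter<minusOnes : ∀ {n} (ε : Sign n) k → lookup ε k ≡ false →
                           minusOnesAfter ε k < minusOnes ε
minusOnesAfter<minusOnes (false ∷ ε) zero    _  = ≤-refl
minusOnesAfter<minusOnes (true  ∷ ε) (suc k) εk = minusOnesAfter<minusOnes ε k εk
minusOnesAfter<minusOnes (false ∷ ε) (suc k) εk = m<n⇒m<1+n (minusOnesAfter<minusOnes ε k εk)

minusOnesAfter-< : ∀ {n} (ε : Sign n) k l → lookup ε l ≡ false → k Fin.< l →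
                   minusOnesAfter ε l < minusOnesAfter ε k
minusOnesAfter-< (_ ∷ ε) zero    (suc l) εl _         = minusOnesAfter<minusOnes ε l εl
minusOnesAfter-< (_ ∷ ε) (suc k) (suc l) εl (s≤s k<l) = minusOnesAfter-< ε k l εl k<l

minusOnesAfter-<⁻¹ : ∀ {n} (ε : Sign n) k l → minusOnesAfter ε l < minusOnesAfter ε k →
                     k Fin.< l
minusOnesAfter-<⁻¹ (_ ∷ ε) zero    zero    lt = ⊥-elim (<-irrefl refl lt)
minusOnesAfter-<⁻¹ (_ ∷ ε) zero    (suc l) lt = s≤s z≤n
minusOnesAfter-<⁻¹ (_ ∷ ε) (suc k) zero    lt = ⊥-elim (<⇒≱ lt (minusOnesAfter≤minusOnes ε k))
minusOnesAfter-<⁻¹ (_ ∷ ε) (suc k) (suc l) lt = s≤s (minusOnesAfter-<⁻¹ ε k l lt)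

onesBefore-< : ∀ {n} (ε : Sign n) j k → lookup ε j ≡ true → j Fin.< k →
               onesBefore ε j < onesBefore ε k
onesBefore-< (true  ∷ ε) zero    (suc k) _  _         = s≤s z≤n
onesBefore-< (true  ∷ ε) (suc j) (suc k) εj (s≤s j<k) = s≤s (onesBefore-< ε j k εj j<k)
onesBefore-< (false ∷ ε) (suc j) (suc k) εj (s≤s j<k) = onesBefore-< ε j k εj j<k

sinkInRow : ∀ {n} (ε : Sign n) t → t < minusOnes ε →
            ∃[ k ] (lookup ε k ≡ false × minusOnesAfter ε k ≡ t)
sinkInRow (true ∷ ε) t lt with sinkInRow ε t lt
... | k , εk , refl = suc k , εk , refl
sinkInRow (false ∷ ε) t lt with m<1+n⇒m<n∨m≡n lt
... | inj₂ refl = zero , refl , refl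
... | inj₁ lt′ with sinkInRow ε t lt′
...   | k , εk , refl = suc k , εk , refl

sourceInColumn : ∀ {n} (ε : Sign n) k c → c < onesBefore ε k →
                 ∃[ j ] (j Fin.< k × lookup ε j ≡ true × onesBefore ε j ≡ c)
sourceInColumn (true ∷ ε) (suc k) zero    _         = zero , s≤s z≤n , refl , refl
sourceInColumn (true ∷ ε) (suc k) (suc c) (s≤s lt) with sourceInColumn ε k c lt
... | j , j<k , εj , refl = suc j , s≤s j<k , εj , refl
sourceInColumn (false ∷ ε) (suc k) c lt with sourceInColumn ε k c lt
... | j , j<k , εj , refl = suc j , s≤s j<k , εj , refl

sinkEntries : ∀ {n} → Sign n → Vec Bool n → List Bool
sinkEntries []          []      = []
sinkEntries (true  ∷ ε) (_ ∷ v) = sinkEntries ε v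
sinkEntries (false ∷ ε) (x ∷ v) = sinkEntries ε v ∷ʳ x

addColumn : List Bool → Filling → Filling
addColumn = zipWith List._∷_

-- Recursion on the first position: a source adds its out-edges as a new
-- first column, a sink adds a new empty top row.
fillingOf : ∀ {n} → Sign n → EdgeSet n → Filling
fillingOf []          []                 = []
fillingOf (true  ∷ ε) ((_ ∷ out) ∷ rest) =
  addColumn (sinkEntries ε out) (fillingOf ε (Vec.map Vec.tail rest))
fillingOf (false ∷ ε) (_ ∷ rest)         = fillingOf ε (Vec.map Vec.tail rest) ∷ʳ []

length-∷ʳ : ∀ {A : Set} (xs : List A) x → length (xs ∷ʳ x) ≡ suc (length xs)
length-∷ʳ xs x = trans (Listₚ.length-++ xs) (+-comm (length xs) 1)

length-sinkEntries : ∀ {n} (ε : Sign n) v → length (sinkEntries ε v) ≡ minusOnes ε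
length-sinkEntries []          []      = refl
length-sinkEntries (true  ∷ ε) (_ ∷ v) = length-sinkEntries ε v
length-sinkEntries (false ∷ ε) (x ∷ v) =
  trans (length-∷ʳ (sinkEntries ε v) x) (cong suc (length-sinkEntries ε v))

length-addColumn : ∀ (a : List Bool) R → length a ≡ length R → length (addColumn a R) ≡ length R
length-addColumn []      []      _  = refl
length-addColumn (x ∷ a) (r ∷ R) eq = cong suc (length-addColumn a R (suc-injective eq))

length-fillingOf : ∀ {n} (ε : Sign n) E → length (fillingOf ε E) ≡ minusOnes ε
length-fillingOf []          []                 = refl
length-fillingOf (true  ∷ ε) ((_ ∷ out) ∷ rest) =
  trans (length-addColumn (sinkEntries ε out) _
           (trans (length-sinkEntries ε out) (sym (length-fillingOf ε _))))
        (length-fillingOf ε _)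
length-fillingOf (false ∷ ε) (_ ∷ rest) =
  trans (length-∷ʳ (fillingOf ε _) []) (cong suc (length-fillingOf ε (Vec.map Vec.tail rest)))

cellAt-∷ʳ-length : ∀ xs x → cellAt (xs ∷ʳ x) (length xs) ≡ x
cellAt-∷ʳ-length []       x = refl
cellAt-∷ʳ-length (y ∷ xs) x = cellAt-∷ʳ-length xs x

cellAt-∷ʳ : ∀ xs x i → i < length xs → cellAt (xs ∷ʳ x) i ≡ cellAt xs i
cellAt-∷ʳ (y ∷ xs) x zero    _        = refl
cellAt-∷ʳ (y ∷ xs) x (suc i) (s≤s lt) = cellAt-∷ʳ xs x i lt

cellAt-sinkEntries : ∀ {n} (ε : Sign n) v k → lookup ε k ≡ false →
                     cellAt (sinkEntries ε v) (minusOnesAfter ε k) ≡ lookup v k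
cellAt-sinkEntries (true  ∷ ε) (x ∷ v) zero    ()
cellAt-sinkEntries (true  ∷ ε) (x ∷ v) (suc k) εk = cellAt-sinkEntries ε v k εk
cellAt-sinkEntries (false ∷ ε) (x ∷ v) zero    _  =
  subst (λ i → cellAt (sinkEntries ε v ∷ʳ x) i ≡ x) (length-sinkEntries ε v)
    (cellAt-∷ʳ-length (sinkEntries ε v) x)
cellAt-sinkEntries (false ∷ ε) (x ∷ v) (suc k) εk = trans
  (cellAt-∷ʳ (sinkEntries ε v) x _
    (subst (minusOnesAfter ε k <_) (sym (length-sinkEntries ε v)) (minusOnesAfter<minusOnes ε k εk)))
  (cellAt-sinkEntries ε v k εk)

row-∷ʳ[] : ∀ F t → row (F ∷ʳ []) t ≡ row F t
row-∷ʳ[] []      zero    = refl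
row-∷ʳ[] []      (suc t) = refl
row-∷ʳ[] (r ∷ F) zero    = refl
row-∷ʳ[] (r ∷ F) (suc t) = row-∷ʳ[] F t

row-beyond : ∀ F t → length F ≤ t → row F t ≡ []
row-beyond []      t       _        = refl
row-beyond (r ∷ F) (suc t) (s≤s le) = row-beyond F t le

row-addColumn : ∀ a R t → length a ≡ length R → t < length R →
                row (addColumn a R) t ≡ cellAt a t ∷ row R t
row-addColumn []      (r ∷ R) t       ()
row-addColumn (x ∷ a) (r ∷ R) zero    _  _        = refl
row-addColumn (x ∷ a) (r ∷ R) (suc t) eq (s≤s lt) = row-addColumn a R t (suc-injective eq) lt

row-fillingOf-source : ∀ {n} (ε : Sign n) a out rest k → lookup ε k ≡ false →
  row (fillingOf (true ∷ ε) ((a ∷ out) ∷ rest)) (minusOnesAfter ε k)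
    ≡ cellAt (sinkEntries ε out) (minusOnesAfter ε k)
      ∷ row (fillingOf ε (Vec.map Vec.tail rest)) (minusOnesAfter ε k)
row-fillingOf-source ε a out rest k εk =
  row-addColumn (sinkEntries ε out) (fillingOf ε _) (minusOnesAfter ε k)
    (trans (length-sinkEntries ε out) (sym (length-fillingOf ε _)))
    (subst (minusOnesAfter ε k <_) (sym (length-fillingOf ε _)) (minusOnesAfter<minusOnes ε k εk))

lookup-map-tail : ∀ {m n} (E : Vec (Vec Bool (suc n)) m) j k →
                  lookup (lookup (Vec.map Vec.tail E) j) k ≡ lookup (lookup E j) (suc k)
lookup-map-tail E j k =
  trans (cong (λ v → lookup v k) (Vecₚ.lookup-map j Vec.tail E)) (lookup-tail (lookup E j))
  where
  lookup-tail : ∀ (v : Vec Bool (suc _)) → lookup (Vec.tail v) k ≡ lookup v (suc k)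
  lookup-tail (x ∷ v) = refl

cell-fillingOf : ∀ {n} (ε : Sign n) E j k → Slot ε j k →
                 cell (fillingOf ε E) (minusOnesAfter ε k) (onesBefore ε j) ≡ lookup (lookup E j) k
cell-fillingOf (true ∷ ε) ((a ∷ out) ∷ rest) zero (suc k) (_ , εk , _)
  rewrite row-fillingOf-source ε a out rest k εk = cellAt-sinkEntries ε out k εk
cell-fillingOf (true ∷ ε) ((a ∷ out) ∷ rest) (suc j) (suc k) (εj , εk , s≤s j<k)
  rewrite row-fillingOf-source ε a out rest k εk =
  trans (cell-fillingOf ε _ j k (εj , εk , j<k)) (lookup-map-tail rest j k)
cell-fillingOf (false ∷ ε) (_ ∷ rest) (suc j) (suc k) (εj , εk , s≤s j<k)
  rewrite row-∷ʳ[] (fillingOf ε (Vec.map Vec.tail rest)) (minusOnesAfter ε k) =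
  trans (cell-fillingOf ε _ j k (εj , εk , j<k)) (lookup-map-tail rest j k)

rowLength-fillingOf : ∀ {n} (ε : Sign n) E k → lookup ε k ≡ false →
                      length (row (fillingOf ε E) (minusOnesAfter ε k)) ≡ onesBefore ε k
rowLength-fillingOf (true ∷ ε) ((a ∷ out) ∷ rest) (suc k) εk
  rewrite row-fillingOf-source ε a out rest k εk = cong suc (rowLength-fillingOf ε _ k εk)
rowLength-fillingOf (false ∷ ε) (_ ∷ rest) zero _
  rewrite row-∷ʳ[] (fillingOf ε (Vec.map Vec.tail rest)) (minusOnes ε)
        | row-beyond (fillingOf ε (Vec.map Vec.tail rest)) (minusOnes ε)
            (≤-reflexive (length-fillingOf ε _)) = refl
rowLength-fillingOf (false ∷ ε) (_ ∷ rest) (suc k) εk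
  rewrite row-∷ʳ[] (fillingOf ε (Vec.map Vec.tail rest)) (minusOnesAfter ε k) =
  rowLength-fillingOf ε _ k εk

countsFrom-suc : ∀ c xs → countsFrom (suc c) xs ≡ map suc (countsFrom c xs)
countsFrom-suc c []           = refl
countsFrom-suc c (true  ∷ xs) = countsFrom-suc (suc c) xs
countsFrom-suc c (false ∷ xs) = cong (suc c ∷_) (countsFrom-suc c xs)

shape-source : ∀ {n} (ε : Sign n) → shape (true ∷ ε) ≡ map suc (shape ε)
shape-source ε = trans (cong reverse (countsFrom-suc 0 (Vec.toList ε)))
                       (sym (Listₚ.reverse-map suc (countsFrom 0 (Vec.toList ε))))

shape-sink : ∀ {n} (ε : Sign n) → shape (false ∷ ε) ≡ shape ε ∷ʳ 0
shape-sink ε = Listₚ.unfold-reverse 0 (countsFrom 0 (Vec.toList ε))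

shape-addColumn : ∀ a R → length a ≡ length R → map length (addColumn a R) ≡ map suc (map length R)
shape-addColumn []      []      _  = refl
shape-addColumn (x ∷ a) (r ∷ R) eq = cong (suc (length r) ∷_) (shape-addColumn a R (suc-injective eq))

shape-fillingOf : ∀ {n} (ε : Sign n) E → map length (fillingOf ε E) ≡ shape ε
shape-fillingOf []          []                 = refl
shape-fillingOf (true  ∷ ε) ((_ ∷ out) ∷ rest) = begin
  map length (addColumn (sinkEntries ε out) F′)
    ≡⟨ shape-addColumn _ F′ (trans (length-sinkEntries ε out) (sym (length-fillingOf ε _))) ⟩
  map suc (map length F′) ≡⟨ cong (map suc) (shape-fillingOf ε _) ⟩
  map suc (shape ε)       ≡⟨ sym (shape-source ε) ⟩
  shape (true ∷ ε)        ∎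
  where open ≡-Reasoning
        F′ = fillingOf ε (Vec.map Vec.tail rest)
shape-fillingOf (false ∷ ε) (_ ∷ rest) = begin
  map length (F′ ∷ʳ []) ≡⟨ Listₚ.map-++ length F′ [ [] ] ⟩
  map length F′ ∷ʳ 0    ≡⟨ cong (_∷ʳ 0) (shape-fillingOf ε _) ⟩
  shape ε ∷ʳ 0          ≡⟨ sym (shape-sink ε) ⟩
  shape (false ∷ ε)     ∎
  where open ≡-Reasoning
        F′ = fillingOf ε (Vec.map Vec.tail rest)

rowLength-cong : ∀ A B → map length A ≡ map length B → ∀ t → length (row A t) ≡ length (row B t)
rowLength-cong []      []      _  t       = refl
rowLength-cong (a ∷ A) (b ∷ B) eq zero    = Listₚ.∷-injectiveˡ eq
rowLength-cong (a ∷ A) (b ∷ B) eq (suc t) = rowLength-cong A B (Listₚ.∷-injectiveʳ eq) t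

module _ {n} (ε : Sign n) {F : Filling} (hasShape : map length F ≡ shape ε) where

  -- The row count and row lengths depend only on the shape, so they can be
  -- read off from the filling of any edge set.
  private
    reference : Filling
    reference = fillingOf ε (Vec.replicate n (Vec.replicate n false))

    sameShape : map length F ≡ map length reference
    sameShape = trans hasShape (sym (shape-fillingOf ε _))

  length-shape : length F ≡ minusOnes ε
  length-shape = begin
    length F                 ≡⟨ sym (Listₚ.length-map length F) ⟩
    length (map length F)    ≡⟨ cong length sameShape ⟩
    length (map length reference) ≡⟨ Listₚ.length-map length reference ⟩
    length reference         ≡⟨ length-fillingOf ε _ ⟩
    minusOnes ε              ∎
    where open ≡-Reasoning

  rowLength-shape : ∀ k → lookup ε k ≡ false → length (row F (minusOnesAfter ε k)) ≡ onesBefore ε k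
  rowLength-shape k εk = trans (rowLength-cong F reference sameShape _) (rowLength-fillingOf ε _ k εk)

  slotOfCell : ∀ t c → c < length (row F t) →
               ∃[ j ] ∃[ k ] (Slot ε j k × minusOnesAfter ε k ≡ t × onesBefore ε j ≡ c)
  slotOfCell t c c<len with sinkInRow ε t (subst (t <_) length-shape (row-index<length F t c c<len))
  ... | k , εk , refl with sourceInColumn ε k c (subst (c <_) (rowLength-shape k εk) c<len)
  ...   | j , j<k , εj , refl = j , k , (εj , εk , j<k) , refl , refl

row-ext : ∀ a b → length a ≡ length b → (∀ c → c < length a → cellAt a c ≡ cellAt b c) → a ≡ b
row-ext []      []      _  _    = refl
row-ext (x ∷ a) (y ∷ b) eq same =
  cong₂ _∷_ (same zero (s≤s z≤n)) (row-ext a b (suc-injective eq) λ c lt → same (suc c) (s≤s lt))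

filling-ext : ∀ A B → map length A ≡ map length B →
              (∀ t c → c < length (row A t) → cell A t c ≡ cell B t c) → A ≡ B
filling-ext []      []      _  _    = refl
filling-ext (a ∷ A) (b ∷ B) eq same =
  cong₂ _∷_ (row-ext a b (Listₚ.∷-injectiveˡ eq) (same zero))
            (filling-ext A B (Listₚ.∷-injectiveʳ eq) λ t → same (suc t))

edgesOf : ∀ {n} → Sign n → Filling → EdgeSet n
edgesOf ε F = tabulate λ j → tabulate λ k →
  does (slot? ε j k) ∧ cell F (minusOnesAfter ε k) (onesBefore ε j)

module _ {n} (ε : Sign n) (F : Filling) {j k : Fin n} where

  lookup-edgesOf : lookup (lookup (edgesOf ε F) j) k
                   ≡ does (slot? ε j k) ∧ cell F (minusOnesAfter ε k) (onesBefore ε j)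
  lookup-edgesOf =
    trans (cong (λ v → lookup v k) (Vecₚ.lookup∘tabulate _ j)) (Vecₚ.lookup∘tabulate _ k)

  edgesOf-slot : Slot ε j k →
                 lookup (lookup (edgesOf ε F) j) k ≡ cell F (minusOnesAfter ε k) (onesBefore ε j)
  edgesOf-slot s = trans lookup-edgesOf
    (cong (_∧ cell F (minusOnesAfter ε k) (onesBefore ε j)) (dec-true (slot? ε j k) s))

  edgesOf-¬slot : ¬ Slot ε j k → lookup (lookup (edgesOf ε F) j) k ≡ false
  edgesOf-¬slot ¬s = trans lookup-edgesOf
    (cong (_∧ cell F (minusOnesAfter ε k) (onesBefore ε j)) (dec-false (slot? ε j k) ¬s))

  edge-edgesOf : edge (edgesOf ε F) j k →
                 Slot ε j k × cell F (minusOnesAfter ε k) (onesBefore ε j) ≡ true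
  edge-edgesOf e with slot? ε j k
  ... | yes s = s , trans (sym (edgesOf-slot s)) e
  ... | no ¬s with trans (sym (edgesOf-¬slot ¬s)) e
  ...   | ()

edgesOf-isNetwork : ∀ {n} (ε : Sign n) F → map length F ≡ shape ε → Closed F →
                    IsNetwork ε (edgesOf ε F)
edgesOf-isNetwork ε F hasShape closed = record
  { ordered   = λ _ _ e → proj₂ (proj₂ (proj₁ (edge-edgesOf ε F e)))
  ; noPath    = noPath
  ; B1        = B1
  ; sourceSgn = λ _ _ e → proj₁ (proj₁ (edge-edgesOf ε F e))
  ; sinkSgn   = λ _ _ e → proj₁ (proj₂ (proj₁ (edge-edgesOf ε F e)))
  }
  where
  noPath : ∀ i j k → ¬ (edge (edgesOf ε F) i j × edge (edgesOf ε F) j k)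
  noPath i j k (eij , ejk) with edge-edgesOf ε F eij | edge-edgesOf ε F ejk
  ... | (_ , εj , _) , _ | (εj′ , _) , _ with trans (sym εj′) εj
  ...   | ()

  B1 : ∀ i j k l → i Fin.< j → j Fin.< k → k Fin.< l →
       edge (edgesOf ε F) i k → edge (edgesOf ε F) j l → edge (edgesOf ε F) j k
  B1 i j k l i<j j<k k<l eik ejl with edge-edgesOf ε F eik | edge-edgesOf ε F ejl
  ... | (εi , εk , _) , left | (εj , εl , _) , below =
    trans (edgesOf-slot ε F (εj , εk , j<k))
      (closed (minusOnesAfter ε k) (onesBefore ε j) inShape
        (minusOnesAfter ε l , minusOnesAfter-< ε k l εl k<l , below)
        (onesBefore ε i , onesBefore-< ε i j εi i<j , left))
    where
    inShape : onesBefore ε j < length (row F (minusOnesAfter ε k))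
    inShape = subst (onesBefore ε j <_) (sym (rowLength-shape ε hasShape k εk)) (onesBefore-< ε j k εj j<k)

edge⇒slot : ∀ {n} {ε : Sign n} {E j k} → IsNetwork ε E → edge E j k → Slot ε j k
edge⇒slot net e = sourceSgn _ _ e , sinkSgn _ _ e , ordered _ _ e
  where open IsNetwork net

¬slot⇒¬edge : ∀ {n} {ε : Sign n} {E j k} → IsNetwork ε E → ¬ Slot ε j k →
              lookup (lookup E j) k ≡ false
¬slot⇒¬edge {E = E} {j} {k} net ¬s with lookup (lookup E j) k in e
... | true  = ⊥-elim (¬s (edge⇒slot net e))
... | false = refl

fillingOf-closed : ∀ {n} (ε : Sign n) E → IsNetwork ε E → Closed (fillingOf ε E)
fillingOf-closed ε E net t c c<len (t' , t'<t , below) (c' , c'<c , left)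
  with slotOfCell ε (shape-fillingOf ε E) t c c<len
... | j , k , (εj , εk , j<k) , refl , refl
  with sinkInRow ε t' (<-trans t'<t (minusOnesAfter<minusOnes ε k εk)) | sourceInColumn ε j c' c'<c
...   | l , εl , refl | i , i<j , εi , refl =
  trans (cell-fillingOf ε E j k (εj , εk , j<k))
    (IsNetwork.B1 net i j k l i<j j<k k<l
      (trans (sym (cell-fillingOf ε E i k (εi , εk , <-trans i<j j<k))) left)
      (trans (sym (cell-fillingOf ε E j l (εj , εl , <-trans j<k k<l))) below))
  where k<l = minusOnesAfter-<⁻¹ ε k l t'<t

edgeSet-ext : ∀ {n} {E E′ : EdgeSet n} →
              (∀ j k → lookup (lookup E j) k ≡ lookup (lookup E′ j) k) → E ≡ E′
edgeSet-ext {E = E} {E′} same = begin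
  E                                                ≡⟨ expand E ⟨
  tabulate (λ j → tabulate (lookup (lookup E j)))  ≡⟨ Vecₚ.tabulate-cong (λ j → Vecₚ.tabulate-cong (same j)) ⟩
  tabulate (λ j → tabulate (lookup (lookup E′ j))) ≡⟨ expand E′ ⟩
  E′                                               ∎
  where
  open ≡-Reasoning
  expand : ∀ E → tabulate (λ j → tabulate (lookup (lookup E j))) ≡ E
  expand E =
    trans (Vecₚ.tabulate-cong (λ j → Vecₚ.tabulate∘lookup (lookup E j))) (Vecₚ.tabulate∘lookup E)

edgesOf-fillingOf : ∀ {n} (ε : Sign n) E → IsNetwork ε E → edgesOf ε (fillingOf ε E) ≡ E
edgesOf-fillingOf ε E net = edgeSet-ext sameEntry
  where
  sameEntry : ∀ j k → lookup (lookup (edgesOf ε (fillingOf ε E)) j) k ≡ lookup (lookup E j) k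
  sameEntry j k with slot? ε j k
  ... | yes s = trans (edgesOf-slot ε (fillingOf ε E) s) (cell-fillingOf ε E j k s)
  ... | no ¬s = trans (edgesOf-¬slot ε (fillingOf ε E) ¬s) (sym (¬slot⇒¬edge net ¬s))

fillingOf-edgesOf : ∀ {n} (ε : Sign n) F → map length F ≡ shape ε → fillingOf ε (edgesOf ε F) ≡ F
fillingOf-edgesOf ε F hasShape = filling-ext A F (trans (shape-fillingOf ε _) (sym hasShape)) sameCell
  where
  A = fillingOf ε (edgesOf ε F)
  sameCell : ∀ t c → c < length (row A t) → cell A t c ≡ cell F t c
  sameCell t c c<len with slotOfCell ε (shape-fillingOf ε (edgesOf ε F)) t c c<len
  ... | j , k , s , refl , refl = trans (cell-fillingOf ε (edgesOf ε F) j k s) (edgesOf-slot ε F s)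

closedFilling↔network : ∀ {n} (ε : Sign n) → ClosedFilling ε ↔ Network ε
closedFilling↔network ε = mk↔ₛ′ to from to∘from from∘to
  where
  to : ClosedFilling ε → Network ε
  to (closedFilling F s c) = network (edgesOf ε F) (edgesOf-isNetwork ε F s c)

  from : Network ε → ClosedFilling ε
  from (network E p) = closedFilling (fillingOf ε E) (shape-fillingOf ε E) (fillingOf-closed ε E p)

  to∘from : ∀ N → to (from N) ≡ N
  to∘from (network E p) = network-≡ (edgesOf-fillingOf ε E p)

  from∘to : ∀ C → from (to C) ≡ C
  from∘to (closedFilling F s c) = closedFilling-≡ (fillingOf-edgesOf ε F s)

proposition4p14 : (m : ℕ) (ε : Sign (suc m)) →
    head ε ≡ true → last ε ≡ false →
    Forest ε ⤖ Network ε
proposition4p14 m ε _ _ = ↔⇒⤖ (closedFilling↔network ε ↔-∘ forest↔closedFilling ε)
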